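{- Let $\mathbf{h}$ be a weakly increasing sequence of positive integers with $\mathbf{h}(i)>i$ for all $i$, and let $S$ be a nonempty $\mathbf{h}$-admissible set. There exists a polynomial $p(x)$ such that $p(n)=\mathcal{I}_\mathbf{h}(S;n)$ for all integers $n\ge\mathbf{j}(S)$.
   Context: $\mathcal{P}_\mathbf{h}=\{(i,j): i<j\le \mathbf{h}(i)\}$. For $\pi\in S_n$, $\mathrm{inv}_\mathbf{h}(\pi)=\{(i,j)\in\mathcal{P}_\mathbf{h}: j\le n,\ \pi_i>\pi_j\}$. $S\subseteq\mathcal{P}_\mathbf{h}$ is $\mathbf{h}$-admissible if $S=\mathrm{inv}_\mathbf{h}(\pi)$ for some permutation $\pi$ of some $S_n$. $\mathcal{I}_\mathbf{h}(S;n)=\#\{\pi\in S_n:\mathrm{inv}_\mathbf{h}(\pi)=S\}$. $\mathbf{j}(S)=\max\{j:(i,j)\in S\}$. -}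

module Defs where

open import Data.Nat using (ℕ; zero; suc; _≤_; _<_; _≤ᵇ_; _<ᵇ_; _≡ᵇ_; _⊔_)
open import Data.Bool using (Bool; true; false; _∧_; not; if_then_else_)
open import Data.List using (List; []; _∷_; map; concatMap; filter; length; foldr; upTo)
open import Data.Bool.ListAction using (all; any)
open import Data.Product using (_×_; _,_; proj₁; proj₂; Σ)
open import Data.Integer using (+_)
open import Data.Rational using (ℚ; _/_; _+_; _*_; 0ℚ)
open import Relation.Binary.PropositionalEquality using (_≡_)
open import Relation.Nullary.Decidable using (does)
import Data.Bool
import Data.List.Membership.Propositional
import Data.List.Properties
import Data.Nat

-- Positions and pairs are 1-based, as in the paper: a permutation π ∈ S_n is
-- the word π_1 … π_n, stored as a list whose k-th entry (k = 1..n) is π_k.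
-- Values are taken in {0,…,n-1}; only their relative order matters.

words : ℕ → ℕ → List (List ℕ)
words m zero    = [] ∷ []
words m (suc k) = concatMap (λ a → map (a ∷_) (words m k)) (upTo m)

distinctᵇ : List ℕ → Bool
distinctᵇ []       = true
distinctᵇ (x ∷ xs) = not (any (λ y → x ≡ᵇ y) xs) ∧ distinctᵇ xs

Sym : ℕ → List (List ℕ)
Sym n = filter (λ w → Data.Bool._≟_ (distinctᵇ w) true) (words n n)

-- π_i for 1 ≤ i ≤ length π (1-based lookup; default 0 outside range)
at : List ℕ → ℕ → ℕ
at []       _             = 0
at (x ∷ xs) zero          = 0
at (x ∷ xs) (suc zero)    = x
at (x ∷ xs) (suc (suc i)) = at xs (suc i)

range1 : ℕ → List ℕ
range1 n = map suc (upTo n)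

invh : (ℕ → ℕ) → ℕ → List ℕ → List (ℕ × ℕ)
invh h n π =
  filter (λ p → Data.Bool._≟_ (test p) true)
         (concatMap (λ i → map (i ,_) (range1 n)) (range1 n))
  where
  test : ℕ × ℕ → Bool
  test (i , j) = (i <ᵇ j) ∧ (j ≤ᵇ h i) ∧ (at π j <ᵇ at π i)

pairEqᵇ : ℕ × ℕ → ℕ × ℕ → Bool
pairEqᵇ (a , b) (c , d) = (a ≡ᵇ c) ∧ (b ≡ᵇ d)

memᵇ : ℕ × ℕ → List (ℕ × ℕ) → Bool
memᵇ p = any (pairEqᵇ p)

sameSetᵇ : List (ℕ × ℕ) → List (ℕ × ℕ) → Bool
sameSetᵇ A B = all (λ p → memᵇ p B) A ∧ all (λ p → memᵇ p A) B

Admissible : (ℕ → ℕ) → List (ℕ × ℕ) → Set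
Admissible h S = Σ ℕ λ n → Σ (List ℕ) λ π →
  Data.List.Membership.Propositional._∈_ π (Sym n)
  × (sameSetᵇ (invh h n π) S ≡ true)

Ih : (ℕ → ℕ) → List (ℕ × ℕ) → ℕ → ℕ
Ih h S n = length (filter (λ π → Data.Bool._≟_ (sameSetᵇ (invh h n π) S) true) (Sym n))

jS : List (ℕ × ℕ) → ℕ
jS S = foldr (λ p m → proj₂ p ⊔ m) 0 S

ℕtoℚ : ℕ → ℚ
ℕtoℚ n = (+ n) / 1

evalPoly : List ℚ → ℚ → ℚ
evalPoly []       x = 0ℚ
evalPoly (c ∷ cs) x = c + x * evalPoly cs x

WeaklyIncreasing : (ℕ → ℕ) → Set
WeaklyIncreasing h = ∀ i j → 1 ≤ i → i ≤ j → h i ≤ h j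

Exceeds : (ℕ → ℕ) → Set
Exceeds h = ∀ i → 1 ≤ i → i < h i

{-# OPTIONS --safe #-}
module Submission where

open import Defs
open import Data.Nat using (ℕ; _≤_)
open import Data.List using (List; [])
open import Data.Product using (_×_; Σ; _,_)
open import Data.Rational using (ℚ)
open import Relation.Binary.PropositionalEquality using (_≡_; _≢_; trans; cong; sym)

-- Write m = j(S). Deleting the last entry of σ ∈ S_{n+1} and standardising the rest is a bijection
-- S_{n+1} ≅ S_n × [n+1], σ ↦ (π, σ_{n+1}). For n > m every pair of S lies in [1, n], and as h(n) > n,
-- σ has h-inversion set S iff π has and σ_{n+1} > π_n: a new inversion (i, n+1) with i < n is
-- impossible, because (i, n) ∉ S forces π_i < π_n. Iterating with the hockey-stick identity, the
-- σ ∈ S_{n+t} with inversion set S lying over such a π number C(t + d, d), where d is the number of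
-- values above π_n. So for n > m, I(S; n) = Σ_π C(n - m - 1 + d_π, d_π) over the π ∈ S_{m+1} with
-- inversion set S, a polynomial in n. The same polynomial is right at n = m: it keeps only the π with
-- d_π = 0, and appending the largest value to a permutation creates no h-inversion.

module RangeSums where

  open import Data.Nat
  open import Data.Nat.Properties
  open import Data.Nat.ListAction using (sum)
  open import Data.Bool using (true; false; if_then_else_)
  open import Data.List using (applyUpTo)
  open import Data.Product using (_,_)
  open import Data.Empty using (⊥-elim)
  open import Function using (_∘_)
  open import Relation.Nullary.Reflects using (ofʸ; ofⁿ)
  open import Relation.Binary.PropositionalEquality
  open ≡-Reasoning

  sumUpTo : ℕ → (ℕ → ℕ) → ℕ
  sumUpTo n f = sum (applyUpTo f n)

  sumUpTo-suc : ∀ n f → sumUpTo (suc n) f ≡ sumUpTo n f + f n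
  sumUpTo-suc zero    f = +-comm (f 0) 0
  sumUpTo-suc (suc n) f = trans (cong (f 0 +_) (sumUpTo-suc n (f ∘ suc))) (sym (+-assoc (f 0) _ _))

  sumUpTo≡0 : ∀ n {f : ℕ → ℕ} → (∀ i → i < n → f i ≡ 0) → sumUpTo n f ≡ 0
  sumUpTo≡0 zero    f≡0 = refl
  sumUpTo≡0 (suc n) f≡0 = cong₂ _+_ (f≡0 0 z<s) (sumUpTo≡0 n (λ i i<n → f≡0 (suc i) (s<s i<n)))

  sumUpTo-cong : ∀ n {f g : ℕ → ℕ} → (∀ i → i < n → f i ≡ g i) → sumUpTo n f ≡ sumUpTo n g
  sumUpTo-cong zero    f≡g = refl
  sumUpTo-cong (suc n) f≡g = cong₂ _+_ (f≡g 0 z<s) (sumUpTo-cong n (λ i i<n → f≡g (suc i) (s<s i<n)))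

  sumUpTo-+ : ∀ m n f → sumUpTo (m + n) f ≡ sumUpTo m f + sumUpTo n (λ i → f (m + i))
  sumUpTo-+ zero    n f = refl
  sumUpTo-+ (suc m) n f = trans (cong (f 0 +_) (sumUpTo-+ m n (f ∘ suc))) (sym (+-assoc (f 0) _ _))

  sumUpTo-reverse : ∀ n f → sumUpTo (suc n) (λ i → f (n ∸ i)) ≡ sumUpTo (suc n) f
  sumUpTo-reverse zero    f = refl
  sumUpTo-reverse (suc n) f = begin
    f (suc n) + sumUpTo (suc n) (λ i → f (n ∸ i))  ≡⟨ cong (f (suc n) +_) (sumUpTo-reverse n f) ⟩
    f (suc n) + sumUpTo (suc n) f                  ≡⟨ +-comm (f (suc n)) _ ⟩
    sumUpTo (suc n) f + f (suc n)                  ≡⟨ sumUpTo-suc (suc n) f ⟨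
    sumUpTo (suc (suc n)) f                        ∎

  sumUpTo-above : ∀ {a n} (f : ℕ → ℕ) → a < n →
    sumUpTo (suc n) (λ v → if a <ᵇ v then f (n ∸ v) else 0) ≡ sumUpTo (suc (n ∸ suc a)) f
  sumUpTo-above {a} f a<n with D , refl ← m≤n⇒∃[o]m+o≡n a<n = begin
    sumUpTo (suc (suc a + D)) g                            ≡⟨ cong (λ k → sumUpTo k g) (+-suc (suc a) D) ⟨
    sumUpTo (suc a + suc D) g                              ≡⟨ sumUpTo-+ (suc a) (suc D) g ⟩
    sumUpTo (suc a) g + sumUpTo (suc D) (λ i → g (suc a + i))
      ≡⟨ cong₂ _+_ (sumUpTo≡0 (suc a) below) (sumUpTo-cong (suc D) above) ⟩
    sumUpTo (suc D) (λ i → f (D ∸ i))                      ≡⟨ sumUpTo-reverse D f ⟩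
    sumUpTo (suc D) f                                      ≡⟨ cong (λ k → sumUpTo (suc k) f) (m+n∸m≡n (suc a) D) ⟨
    sumUpTo (suc (suc a + D ∸ suc a)) f                    ∎
    where
    g : ℕ → ℕ
    g v = if a <ᵇ v then f (suc a + D ∸ v) else 0
    below : ∀ v → v < suc a → g v ≡ 0
    below v v<1+a with a <ᵇ v | <ᵇ-reflects-< a v
    ... | false | _       = refl
    ... | true  | ofʸ a<v = ⊥-elim (<⇒≱ a<v (s≤s⁻¹ v<1+a))
    above : ∀ i → i < suc D → g (suc a + i) ≡ f (D ∸ i)
    above i _ with a <ᵇ suc a + i | <ᵇ-reflects-< a (suc a + i)
    ... | true  | _       = cong f ([m+n]∸[m+o]≡n∸o (suc a) D i)
    ... | false | ofⁿ a≮v = ⊥-elim (a≮v (s≤s (m≤m+n a i)))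

module Binomials where

  open import Data.Nat
  open import Data.Nat.Properties
  open import Data.Nat.Combinatorics using (_C_; nC1≡n; nCk+nC[k+1]≡[n+1]C[k+1])
  open import Relation.Binary.PropositionalEquality
  open ≡-Reasoning
  open RangeSums

  [1+k]*[1+n]C[1+k]≡[1+n]*nCk : ∀ n k → suc k * (suc n C suc k) ≡ suc n * (n C k)
  [1+k]*[1+n]C[1+k]≡[1+n]*nCk zero    zero    = refl
  [1+k]*[1+n]C[1+k]≡[1+n]*nCk zero    (suc k) = *-zeroʳ (suc (suc k))
  [1+k]*[1+n]C[1+k]≡[1+n]*nCk (suc n) zero    = trans (+-identityʳ _) (trans (nC1≡n (suc (suc n))) (sym (*-identityʳ _)))
  [1+k]*[1+n]C[1+k]≡[1+n]*nCk (suc n) (suc k) = begin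
    suc (suc k) * (suc (suc n) C suc (suc k))
      ≡⟨ cong (suc (suc k) *_) (nCk+nC[k+1]≡[n+1]C[k+1] (suc n) (suc k)) ⟨
    suc (suc k) * (suc n C suc k + suc n C suc (suc k))
      ≡⟨ *-distribˡ-+ (suc (suc k)) (suc n C suc k) _ ⟩
    suc n C suc k + suc k * (suc n C suc k) + suc (suc k) * (suc n C suc (suc k))
      ≡⟨ cong₂ (λ x y → suc n C suc k + x + y)
               ([1+k]*[1+n]C[1+k]≡[1+n]*nCk n k) ([1+k]*[1+n]C[1+k]≡[1+n]*nCk n (suc k)) ⟩
    suc n C suc k + suc n * (n C k) + suc n * (n C suc k)
      ≡⟨ +-assoc (suc n C suc k) _ _ ⟩
    suc n C suc k + (suc n * (n C k) + suc n * (n C suc k))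
      ≡⟨ cong (suc n C suc k +_) (*-distribˡ-+ (suc n) (n C k) (n C suc k)) ⟨
    suc n C suc k + suc n * (n C k + n C suc k)
      ≡⟨ cong (λ x → suc n C suc k + suc n * x) (nCk+nC[k+1]≡[n+1]C[k+1] n k) ⟩
    suc (suc n) * (suc n C suc k) ∎

  [1+k]*nC[1+k]≡n*[n∸1]Ck : ∀ n k → suc k * (n C suc k) ≡ n * (pred n C k)
  [1+k]*nC[1+k]≡n*[n∸1]Ck zero    k = *-zeroʳ (suc k)
  [1+k]*nC[1+k]≡n*[n∸1]Ck (suc n) k = [1+k]*[1+n]C[1+k]≡[1+n]*nCk n k

  Σ[k+i]Ci≡[1+k+D]CD : ∀ k D → sumUpTo (suc D) (λ i → (k + i) C i) ≡ (suc k + D) C D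
  Σ[k+i]Ci≡[1+k+D]CD k zero    = refl
  Σ[k+i]Ci≡[1+k+D]CD k (suc D) = begin
    sumUpTo (suc (suc D)) (λ i → (k + i) C i)
      ≡⟨ sumUpTo-suc (suc D) (λ i → (k + i) C i) ⟩
    sumUpTo (suc D) (λ i → (k + i) C i) + (k + suc D) C suc D
      ≡⟨ cong₂ (λ x y → x + y C suc D) (Σ[k+i]Ci≡[1+k+D]CD k D) (+-suc k D) ⟩
    (suc k + D) C D + (suc k + D) C suc D
      ≡⟨ nCk+nC[k+1]≡[n+1]C[k+1] (suc k + D) D ⟩
    suc (suc k + D) C suc D
      ≡⟨ cong (_C suc D) (+-suc (suc k) D) ⟨
    (suc k + suc D) C suc D ∎

module Polynomials where

  open import Data.Nat as ℕ using (zero; suc; pred; _∸_)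
  import Data.Nat.Properties as ℕ
  open import Data.Nat.Combinatorics using (_C_)
  open import Data.Nat.Coprimality using (1-coprimeTo) renaming (sym to coprime-sym)
  open import Data.Nat.ListAction using (sum)
  import Data.Integer as ℤ
  import Data.Integer.Solver
  open import Data.Rational using (mkℚ; toℚᵘ; 0ℚ; 1ℚ; _+_; _*_; _-_)
  import Data.Rational.Properties as ℚ
  import Data.Rational.Unnormalised as ℚᵘ
  import Data.Rational.Unnormalised.Properties as ℚᵘ
  open import Data.Rational.Solver using (module +-*-Solver)
  open import Data.List using (_∷_; map; foldr)
  open import Relation.Binary.PropositionalEquality
  open ≡-Reasoning
  open Binomials using ([1+k]*nC[1+k]≡n*[n∸1]Ck)

  ℕtoℚ≡mkℚ : ∀ n → ℕtoℚ n ≡ mkℚ (ℤ.+ n) 0 (coprime-sym (1-coprimeTo n))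
  ℕtoℚ≡mkℚ n = ℚ.normalize-coprime (coprime-sym (1-coprimeTo n))

  ℕtoℚ-suc : ∀ n → ℕtoℚ (suc n) ≡ 1ℚ + ℕtoℚ n
  ℕtoℚ-suc n = ℚ.toℚᵘ-injective (ℚᵘ.≃-trans numerators (ℚᵘ.≃-sym (ℚ.toℚᵘ-homo-+ 1ℚ (ℕtoℚ n))))
    where
    open Data.Integer.Solver.+-*-Solver
    numerators : toℚᵘ (ℕtoℚ (suc n)) ℚᵘ.≃ toℚᵘ 1ℚ ℚᵘ.+ toℚᵘ (ℕtoℚ n)
    numerators rewrite ℕtoℚ≡mkℚ (suc n) | ℕtoℚ≡mkℚ n =
      ℚᵘ.*≡* (solve 1 (λ x → (one :+ x) :* one := (one :+ x :* one) :* one) refl (ℤ.+ n))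
      where one = con (ℤ.+ 1)

  ℕtoℚ-+ : ∀ m n → ℕtoℚ (m ℕ.+ n) ≡ ℕtoℚ m + ℕtoℚ n
  ℕtoℚ-+ zero    n = sym (ℚ.+-identityˡ (ℕtoℚ n))
  ℕtoℚ-+ (suc m) n = begin
    ℕtoℚ (suc (m ℕ.+ n))    ≡⟨ ℕtoℚ-suc (m ℕ.+ n) ⟩
    1ℚ + ℕtoℚ (m ℕ.+ n)     ≡⟨ cong (1ℚ +_) (ℕtoℚ-+ m n) ⟩
    1ℚ + (ℕtoℚ m + ℕtoℚ n)  ≡⟨ ℚ.+-assoc 1ℚ (ℕtoℚ m) (ℕtoℚ n) ⟨
    1ℚ + ℕtoℚ m + ℕtoℚ n    ≡⟨ cong (_+ ℕtoℚ n) (ℕtoℚ-suc m) ⟨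
    ℕtoℚ (suc m) + ℕtoℚ n   ∎

  ℕtoℚ-* : ∀ m n → ℕtoℚ (m ℕ.* n) ≡ ℕtoℚ m * ℕtoℚ n
  ℕtoℚ-* zero    n = sym (ℚ.*-zeroˡ (ℕtoℚ n))
  ℕtoℚ-* (suc m) n = begin
    ℕtoℚ (n ℕ.+ m ℕ.* n)        ≡⟨ ℕtoℚ-+ n (m ℕ.* n) ⟩
    ℕtoℚ n + ℕtoℚ (m ℕ.* n)     ≡⟨ cong (ℕtoℚ n +_) (ℕtoℚ-* m n) ⟩
    ℕtoℚ n + ℕtoℚ m * ℕtoℚ n    ≡⟨ solve 2 (λ a b → b :+ a :* b := (con 1ℚ :+ a) :* b) refl (ℕtoℚ m) (ℕtoℚ n) ⟩
    (1ℚ + ℕtoℚ m) * ℕtoℚ n      ≡⟨ cong (_* ℕtoℚ n) (ℕtoℚ-suc m) ⟨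
    ℕtoℚ (suc m) * ℕtoℚ n       ∎
    where open +-*-Solver

  ℕtoℚ-∸ : ∀ {m n} → m ≤ n → ℕtoℚ (n ∸ m) ≡ ℕtoℚ n - ℕtoℚ m
  ℕtoℚ-∸ {m} {n} m≤n = begin
    ℕtoℚ (n ∸ m)                     ≡⟨ solve 2 (λ a b → a := a :+ b :- b) refl (ℕtoℚ (n ∸ m)) (ℕtoℚ m) ⟩
    ℕtoℚ (n ∸ m) + ℕtoℚ m - ℕtoℚ m   ≡⟨ cong (_- ℕtoℚ m) (ℕtoℚ-+ (n ∸ m) m) ⟨
    ℕtoℚ (n ∸ m ℕ.+ m) - ℕtoℚ m      ≡⟨ cong (λ k → ℕtoℚ k - ℕtoℚ m) (ℕ.m∸n+n≡m m≤n) ⟩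
    ℕtoℚ n - ℕtoℚ m                  ∎
    where open +-*-Solver

  1/[1+_] : ℕ → ℚ
  1/[1+ n ] = mkℚ (ℤ.+ 1) n (1-coprimeTo (suc n))

  1/[1+n]*[1+n]≡1 : ∀ n → 1/[1+ n ] * ℕtoℚ (suc n) ≡ 1ℚ
  1/[1+n]*[1+n]≡1 n = ℚ.toℚᵘ-injective (ℚᵘ.≃-trans (ℚ.toℚᵘ-homo-* 1/[1+ n ] (ℕtoℚ (suc n))) numerators)
    where
    open Data.Integer.Solver.+-*-Solver
    numerators : toℚᵘ 1/[1+ n ] ℚᵘ.* toℚᵘ (ℕtoℚ (suc n)) ℚᵘ.≃ toℚᵘ 1ℚ
    numerators rewrite ℕtoℚ≡mkℚ (suc n) =
      ℚᵘ.*≡* (solve 1 (λ x → (one :* (one :+ x)) :* one := one :* ((one :+ x) :* one)) refl (ℤ.+ n))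
      where one = con (ℤ.+ 1)

  infixl 6 _+ₚ_
  infixl 7 _·ₚ_

  _+ₚ_ : List ℚ → List ℚ → List ℚ
  []      +ₚ q       = q
  (a ∷ p) +ₚ []      = a ∷ p
  (a ∷ p) +ₚ (b ∷ q) = a + b ∷ p +ₚ q

  _·ₚ_ : ℚ → List ℚ → List ℚ
  c ·ₚ p = map (c *_) p

  [X+_]*ₚ : ℚ → List ℚ → List ℚ
  [X+ c ]*ₚ p = (0ℚ ∷ p) +ₚ c ·ₚ p

  sumₚ : List (List ℚ) → List ℚ
  sumₚ = foldr _+ₚ_ []

  module _ where
    open +-*-Solver

    evalPoly-+ₚ : ∀ p q x → evalPoly (p +ₚ q) x ≡ evalPoly p x + evalPoly q x
    evalPoly-+ₚ []      q       x = sym (ℚ.+-identityˡ _)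
    evalPoly-+ₚ (a ∷ p) []      x = sym (ℚ.+-identityʳ _)
    evalPoly-+ₚ (a ∷ p) (b ∷ q) x rewrite evalPoly-+ₚ p q x =
      solve 5 (λ a b x P Q → a :+ b :+ x :* (P :+ Q) := a :+ x :* P :+ (b :+ x :* Q))
            refl a b x (evalPoly p x) (evalPoly q x)

    evalPoly-·ₚ : ∀ c p x → evalPoly (c ·ₚ p) x ≡ c * evalPoly p x
    evalPoly-·ₚ c []      x = sym (ℚ.*-zeroʳ c)
    evalPoly-·ₚ c (a ∷ p) x rewrite evalPoly-·ₚ c p x =
      solve 4 (λ c a x P → c :* a :+ x :* (c :* P) := c :* (a :+ x :* P)) refl c a x (evalPoly p x)

    evalPoly-[X+c]*ₚ : ∀ c p x → evalPoly ([X+ c ]*ₚ p) x ≡ (x + c) * evalPoly p x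
    evalPoly-[X+c]*ₚ c p x rewrite evalPoly-+ₚ (0ℚ ∷ p) (c ·ₚ p) x | evalPoly-·ₚ c p x =
      solve 3 (λ x c P → con 0ℚ :+ x :* P :+ c :* P := (x :+ c) :* P) refl x c (evalPoly p x)

  evalPoly-sumₚ : ∀ {A : Set} (q : A → List ℚ) (g : A → ℕ) x → (∀ y → evalPoly (q y) x ≡ ℕtoℚ (g y)) →
                  ∀ ys → evalPoly (sumₚ (map q ys)) x ≡ ℕtoℚ (sum (map g ys))
  evalPoly-sumₚ q g x q≗g []       = refl
  evalPoly-sumₚ q g x q≗g (y ∷ ys) = begin
    evalPoly (q y +ₚ sumₚ (map q ys)) x               ≡⟨ evalPoly-+ₚ (q y) _ x ⟩
    evalPoly (q y) x + evalPoly (sumₚ (map q ys)) x   ≡⟨ cong₂ _+_ (q≗g y) (evalPoly-sumₚ q g x q≗g ys) ⟩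
    ℕtoℚ (g y) + ℕtoℚ (sum (map g ys))                ≡⟨ ℕtoℚ-+ (g y) _ ⟨
    ℕtoℚ (g y ℕ.+ sum (map g ys))                     ∎

  binomialPoly : ℕ → ℕ → List ℚ
  binomialPoly a zero    = 1ℚ ∷ []
  binomialPoly a (suc D) = 1/[1+ D ] ·ₚ [X+ ℕtoℚ (suc D) - ℕtoℚ a ]*ₚ (binomialPoly a D)

  -- binomialPoly a D is (x - a + 1) ⋯ (x - a + D) / D!. At n = a ∸ 1 the truncated subtraction makes
  -- the right-hand side (D ∸ 1) C D, which is 1 for D = 0 and 0 otherwise, as the polynomial is.
  evalPoly-binomialPoly : ∀ a D {n} → a ≤ suc n → evalPoly (binomialPoly a D) (ℕtoℚ n) ≡ ℕtoℚ ((n ℕ.+ D ∸ a) C D)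
  evalPoly-binomialPoly a zero    {n} a≤1+n = trans (cong (1ℚ +_) (ℚ.*-zeroʳ (ℕtoℚ n))) (ℚ.+-identityʳ 1ℚ)
  evalPoly-binomialPoly a (suc D) {n} a≤1+n = begin
    evalPoly (binomialPoly a (suc D)) x
      ≡⟨ evalPoly-·ₚ 1/[1+ D ] ([X+ c ]*ₚ (binomialPoly a D)) x ⟩
    1/[1+ D ] * evalPoly ([X+ c ]*ₚ (binomialPoly a D)) x
      ≡⟨ cong (1/[1+ D ] *_) (evalPoly-[X+c]*ₚ c (binomialPoly a D) x) ⟩
    1/[1+ D ] * ((x + c) * evalPoly (binomialPoly a D) x)
      ≡⟨ cong₂ (λ y z → 1/[1+ D ] * (y * z)) x+c≡k (evalPoly-binomialPoly a D a≤1+n) ⟩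
    1/[1+ D ] * (ℕtoℚ k * ℕtoℚ ((n ℕ.+ D ∸ a) C D))
      ≡⟨ cong (λ y → 1/[1+ D ] * (ℕtoℚ k * ℕtoℚ (y C D))) pred-k ⟨
    1/[1+ D ] * (ℕtoℚ k * ℕtoℚ (pred k C D))
      ≡⟨ cong (1/[1+ D ] *_) (ℕtoℚ-* k (pred k C D)) ⟨
    1/[1+ D ] * ℕtoℚ (k ℕ.* (pred k C D))
      ≡⟨ cong (λ y → 1/[1+ D ] * ℕtoℚ y) ([1+k]*nC[1+k]≡n*[n∸1]Ck k D) ⟨
    1/[1+ D ] * ℕtoℚ (suc D ℕ.* (k C suc D))
      ≡⟨ cong (1/[1+ D ] *_) (ℕtoℚ-* (suc D) (k C suc D)) ⟩
    1/[1+ D ] * (ℕtoℚ (suc D) * ℕtoℚ (k C suc D))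
      ≡⟨ ℚ.*-assoc 1/[1+ D ] (ℕtoℚ (suc D)) (ℕtoℚ (k C suc D)) ⟨
    1/[1+ D ] * ℕtoℚ (suc D) * ℕtoℚ (k C suc D)
      ≡⟨ cong (_* ℕtoℚ (k C suc D)) (1/[1+n]*[1+n]≡1 D) ⟩
    1ℚ * ℕtoℚ (k C suc D)
      ≡⟨ ℚ.*-identityˡ (ℕtoℚ (k C suc D)) ⟩
    ℕtoℚ (k C suc D) ∎
    where
    x = ℕtoℚ n
    c = ℕtoℚ (suc D) - ℕtoℚ a
    k = n ℕ.+ suc D ∸ a
    x+c≡k : x + c ≡ ℕtoℚ k
    x+c≡k = begin
      x + (ℕtoℚ (suc D) - ℕtoℚ a)  ≡⟨ solve 3 (λ x d a → x :+ (d :- a) := x :+ d :- a) refl x (ℕtoℚ (suc D)) (ℕtoℚ a) ⟩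
      x + ℕtoℚ (suc D) - ℕtoℚ a    ≡⟨ cong (_- ℕtoℚ a) (ℕtoℚ-+ n (suc D)) ⟨
      ℕtoℚ (n ℕ.+ suc D) - ℕtoℚ a  ≡⟨ ℕtoℚ-∸ (ℕ.≤-trans a≤1+n 1+n≤n+[1+D]) ⟨
      ℕtoℚ k                       ∎
      where
      open +-*-Solver
      1+n≤n+[1+D] : suc n ≤ n ℕ.+ suc D
      1+n≤n+[1+D] = subst (suc n ≤_) (sym (ℕ.+-suc n D)) (ℕ.s≤s (ℕ.m≤m+n n D))
    pred-k : pred k ≡ n ℕ.+ D ∸ a
    pred-k = trans (ℕ.pred[m∸n]≡m∸[1+n] (n ℕ.+ suc D) a) (cong (_∸ suc a) (ℕ.+-suc n D))

module ListSums where

  open import Data.Nat using (ℕ; suc; _+_)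
  open import Data.Nat.ListAction using (sum)
  open import Data.Nat.ListAction.Properties using (sum-++)
  open import Data.Bool using (Bool; true; false; if_then_else_)
  import Data.Bool as Bool
  open import Data.List using (_∷_; _++_; map; concatMap; filter; length; upTo; cartesianProductWith)
  import Data.List.Properties as List
  open import Function using (_∘_)
  open import Relation.Binary.PropositionalEquality
  open RangeSums using (sumUpTo)

  private variable A B C : Set

  sum-map-cartesianProductWith : ∀ (f : A → B → C) (F : C → ℕ) xs ys →
    sum (map F (cartesianProductWith f xs ys)) ≡ sum (map (λ x → sum (map (F ∘ f x) ys)) xs)
  sum-map-cartesianProductWith f F []       ys = refl
  sum-map-cartesianProductWith f F (x ∷ xs) ys = begin
    sum (map F (map (f x) ys ++ cartesianProductWith f xs ys))
      ≡⟨ cong sum (List.map-++ F (map (f x) ys) _) ⟩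
    sum (map F (map (f x) ys) ++ map F (cartesianProductWith f xs ys))
      ≡⟨ sum-++ (map F (map (f x) ys)) _ ⟩
    sum (map F (map (f x) ys)) + sum (map F (cartesianProductWith f xs ys))
      ≡⟨ cong₂ _+_ (cong sum (sym (List.map-∘ ys))) (sum-map-cartesianProductWith f F xs ys) ⟩
    sum (map (F ∘ f x) ys) + sum (map (λ x → sum (map (F ∘ f x) ys)) xs) ∎
    where open ≡-Reasoning

  concatMap-map≡cartesianProductWith : ∀ (f : A → B → C) xs ys →
    concatMap (λ x → map (f x) ys) xs ≡ cartesianProductWith f xs ys
  concatMap-map≡cartesianProductWith f []       ys = refl
  concatMap-map≡cartesianProductWith f (x ∷ xs) ys = cong (map (f x) ys ++_) (concatMap-map≡cartesianProductWith f xs ys)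

  length-filter≡sum : ∀ (P : A → Bool) xs →
    length (filter (λ x → Bool._≟_ (P x) true) xs) ≡ sum (map (λ x → if P x then 1 else 0) xs)
  length-filter≡sum P []       = refl
  length-filter≡sum P (x ∷ xs) with P x
  ... | true  = cong suc (length-filter≡sum P xs)
  ... | false = length-filter≡sum P xs

  sum-map-upTo≡sumUpTo : ∀ (f : ℕ → ℕ) n → sum (map f (upTo n)) ≡ sumUpTo n f
  sum-map-upTo≡sumUpTo f n = cong sum (List.map-applyUpTo (λ i → i) f n)

module Permutations where

  open import Data.Nat
  open import Data.Nat.Properties
  open import Data.Nat.ListAction using (sum)
  open import Data.Nat.ListAction.Properties using (sum-↭)
  open import Data.Bool using (true; false; T)
  import Data.Bool as Bool
  open import Data.Bool.Properties using (T-≡)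
  open import Data.Bool.ListAction using (any)
  open import Data.List using (_∷_; _++_; _∷ʳ_; map; length; upTo; cartesianProductWith; initLast; _∷ʳ′_)
  import Data.List.Properties as List
  open import Data.List.Membership.Propositional using (_∈_)
  open import Data.List.Membership.Propositional.Properties
    using (∈-filter⁺; ∈-filter⁻; ∈-map⁻; ∈-upTo⁺; ∈-upTo⁻; ∈-cartesianProductWith⁺; ∈-cartesianProductWith⁻)
  open import Data.List.Membership.Propositional.Properties.WithK using (unique∧set⇒bag)
  open import Data.List.Relation.Binary.BagAndSetEquality using (∼bag⇒↭)
  open import Data.List.Relation.Binary.Permutation.Propositional using (_↭_)
  import Data.List.Relation.Binary.Permutation.Propositional.Properties as ↭
  open import Data.List.Relation.Unary.Any using (here; there)
  open import Data.List.Relation.Unary.All as All using (All; []; _∷_)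
  import Data.List.Relation.Unary.All.Properties as All
  open import Data.List.Relation.Unary.AllPairs using ([]; _∷_)
  open import Data.List.Relation.Unary.Unique.Propositional using (Unique)
  import Data.List.Relation.Unary.Unique.Propositional.Properties as Unique
  open import Data.Product using (_,_; ∃₂)
  open import Data.Empty using (⊥; ⊥-elim)
  open import Function using (_∘_; _⇔_; mk⇔; Equivalence)
  open import Relation.Nullary using (yes; no)
  open import Relation.Binary.Definitions using (tri<; tri≈; tri>)
  open import Relation.Binary.PropositionalEquality
  open RangeSums using (sumUpTo)
  open ListSums

  module _ {x : ℕ} where

    All≢⇒any≡ᵇ≡false : ∀ {xs} → All (x ≢_) xs → any (x ≡ᵇ_) xs ≡ false
    All≢⇒any≡ᵇ≡false {[]}     []          = refl
    All≢⇒any≡ᵇ≡false {y ∷ xs} (x≢y ∷ x∉) with x ≡ᵇ y in eq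
    ... | true  = ⊥-elim (x≢y (≡ᵇ⇒≡ x y (Equivalence.from T-≡ eq)))
    ... | false = All≢⇒any≡ᵇ≡false x∉

    any≡ᵇ≡false⇒All≢ : ∀ xs → any (x ≡ᵇ_) xs ≡ false → All (x ≢_) xs
    any≡ᵇ≡false⇒All≢ []       _ = []
    any≡ᵇ≡false⇒All≢ (y ∷ xs) e with x ≡ᵇ y in eq
    ... | false = (λ x≡y → subst T eq (≡⇒≡ᵇ x y x≡y)) ∷ any≡ᵇ≡false⇒All≢ xs e

  Unique⇒distinctᵇ : ∀ {xs} → Unique xs → distinctᵇ xs ≡ true
  Unique⇒distinctᵇ []                      = refl
  Unique⇒distinctᵇ {x ∷ xs} (x∉ ∷ unique) rewrite All≢⇒any≡ᵇ≡false x∉ = Unique⇒distinctᵇ unique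

  distinctᵇ⇒Unique : ∀ xs → distinctᵇ xs ≡ true → Unique xs
  distinctᵇ⇒Unique []       _ = []
  distinctᵇ⇒Unique (x ∷ xs) e with any (x ≡ᵇ_) xs in eq
  ... | false = any≡ᵇ≡false⇒All≢ xs eq ∷ distinctᵇ⇒Unique xs e

  words-suc : ∀ m k → words m (suc k) ≡ cartesianProductWith _∷_ (upTo m) (words m k)
  words-suc m k = concatMap-map≡cartesianProductWith _∷_ (upTo m) (words m k)

  ∈-words⁻ : ∀ m k {w} → w ∈ words m k → length w ≡ k × All (_< m) w
  ∈-words⁻ m zero    (here refl) = refl , []
  ∈-words⁻ m (suc k) w∈ rewrite words-suc m k
    with a , w , a∈ , w∈ , refl ← ∈-cartesianProductWith⁻ _∷_ (upTo m) (words m k) w∈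
    with length≡k , w<m ← ∈-words⁻ m k w∈ = cong suc length≡k , ∈-upTo⁻ a∈ ∷ w<m

  ∈-words⁺ : ∀ m k {w} → length w ≡ k → All (_< m) w → w ∈ words m k
  ∈-words⁺ m zero    {[]}    _        []          = here refl
  ∈-words⁺ m (suc k) {a ∷ w} length≡k (a<m ∷ w<m) rewrite words-suc m k =
    ∈-cartesianProductWith⁺ _∷_ (∈-upTo⁺ a<m) (∈-words⁺ m k (suc-injective length≡k) w<m)

  words-unique : ∀ m k → Unique (words m k)
  words-unique m zero    = [] ∷ []
  words-unique m (suc k) rewrite words-suc m k =
    Unique.cartesianProductWith⁺ _∷_ List.∷-injective (Unique.upTo⁺ m) (words-unique m k)

  IsPerm : ℕ → List ℕ → Set
  IsPerm n π = length π ≡ n × All (_< n) π × Unique π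

  ∈-Sym⁻ : ∀ n {π} → π ∈ Sym n → IsPerm n π
  ∈-Sym⁻ n π∈ with w∈ , distinct ← ∈-filter⁻ (λ w → Bool._≟_ (distinctᵇ w) true) π∈
              with length≡n , π<n ← ∈-words⁻ n n w∈ = length≡n , π<n , distinctᵇ⇒Unique _ distinct

  ∈-Sym⁺ : ∀ n {π} → IsPerm n π → π ∈ Sym n
  ∈-Sym⁺ n (length≡n , π<n , unique) =
    ∈-filter⁺ (λ w → Bool._≟_ (distinctᵇ w) true) (∈-words⁺ n n length≡n π<n) (Unique⇒distinctᵇ unique)

  Sym-unique : ∀ n → Unique (Sym n)
  Sym-unique n = Unique.filter⁺ (λ w → Bool._≟_ (distinctᵇ w) true) (words-unique n n)

  punchIn : ℕ → ℕ → ℕ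
  punchIn v x with x <? v
  ... | yes _ = x
  ... | no  _ = suc x

  punchOut : ℕ → ℕ → ℕ
  punchOut v x with x <? v
  ... | yes _ = x
  ... | no  _ = pred x

  punchIn-mono-< : ∀ v {x y} → x < y → punchIn v x < punchIn v y
  punchIn-mono-< v {x} {y} x<y with x <? v | y <? v
  ... | yes _   | yes _   = x<y
  ... | yes _   | no  _   = m<n⇒m<1+n x<y
  ... | no  x≮v | yes y<v = ⊥-elim (x≮v (<-trans x<y y<v))
  ... | no  _   | no  _   = s<s x<y

  punchIn-cancel-< : ∀ v {x y} → punchIn v x < punchIn v y → x < y
  punchIn-cancel-< v {x} {y} p<p with <-cmp x y
  ... | tri< x<y _ _ = x<y
  ... | tri≈ _ refl _ = ⊥-elim (<-irrefl refl p<p)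
  ... | tri> _ _ y<x = ⊥-elim (<-asym p<p (punchIn-mono-< v y<x))

  punchIn-injective : ∀ v {x y} → punchIn v x ≡ punchIn v y → x ≡ y
  punchIn-injective v {x} {y} p≡p with <-cmp x y
  ... | tri< x<y _ _ = ⊥-elim (<-irrefl p≡p (punchIn-mono-< v x<y))
  ... | tri≈ _ x≡y _ = x≡y
  ... | tri> _ _ y<x = ⊥-elim (<-irrefl (sym p≡p) (punchIn-mono-< v y<x))

  punchInᵥ≢v : ∀ v x → punchIn v x ≢ v
  punchInᵥ≢v v x p≡v with x <? v
  ... | yes x<v = <-irrefl p≡v x<v
  ... | no  x≮v = x≮v (subst (x <_) p≡v ≤-refl)

  punchIn-< : ∀ v {x n} → x < n → punchIn v x < suc n
  punchIn-< v {x} x<n with x <? v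
  ... | yes _ = m<n⇒m<1+n x<n
  ... | no  _ = s<s x<n

  v<punchIn⇔v≤x : ∀ v x → v < punchIn v x ⇔ v ≤ x
  v<punchIn⇔v≤x v x with x <? v
  ... | yes x<v = mk⇔ (λ v<x → ⊥-elim (<-asym v<x x<v)) (λ v≤x → ⊥-elim (<⇒≱ x<v v≤x))
  ... | no  x≮v = mk⇔ s≤s⁻¹ s≤s

  punchIn-punchOut : ∀ {v x} → x ≢ v → punchIn v (punchOut v x) ≡ x
  punchIn-punchOut {v} {x} x≢v with x <? v
  punchIn-punchOut {v} {x} x≢v | yes x<v with x <? v
  ... | yes _   = refl
  ... | no  x≮v = ⊥-elim (x≮v x<v)
  punchIn-punchOut {v} {zero}  x≢v | no x≮v = ⊥-elim (x≢v (sym (n≤0⇒n≡0 (≮⇒≥ x≮v))))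
  punchIn-punchOut {v} {suc x} x≢v | no x≮v with x <? v
  ... | yes x<v = ⊥-elim (x≢v (≤-antisym x<v (≮⇒≥ x≮v)))
  ... | no  _   = refl

  punchOut-< : ∀ {v x n} → v < suc n → x < suc n → x ≢ v → punchOut v x < n
  punchOut-< {v} {x} v≤n x<1+n x≢v with x <? v
  ... | yes x<v = <-≤-trans x<v (s≤s⁻¹ v≤n)
  punchOut-< {v} {zero}  v≤n x<1+n x≢v | no x≮v = ⊥-elim (x≢v (sym (n≤0⇒n≡0 (≮⇒≥ x≮v))))
  punchOut-< {v} {suc x} v≤n x<1+n x≢v | no x≮v = s≤s⁻¹ x<1+n

  extend : List ℕ → ℕ → List ℕ
  extend π v = map (punchIn v) π ∷ʳ v

  extend-injective : ∀ {π σ v w} → extend π v ≡ extend σ w → π ≡ σ × v ≡ w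
  extend-injective {π} {σ} e with p≡s , refl ← List.∷ʳ-injective (map (punchIn _) π) (map (punchIn _) σ) e =
    List.map-injective (punchIn-injective _) p≡s , refl

  length-∷ʳ : ∀ (xs : List ℕ) v → length (xs ∷ʳ v) ≡ suc (length xs)
  length-∷ʳ xs v = trans (List.length-++ xs) (+-comm (length xs) 1)

  length-extend : ∀ π v → length (extend π v) ≡ suc (length π)
  length-extend π v = trans (length-∷ʳ (map (punchIn v) π) v) (cong suc (List.length-map (punchIn v) π))

  Unique-∷ʳ⁻ : ∀ (xs : List ℕ) {v} → Unique (xs ∷ʳ v) → All (_≢ v) xs × Unique xs
  Unique-∷ʳ⁻ []       _               = [] , []
  Unique-∷ʳ⁻ (x ∷ xs) (x∉ ∷ unique) with xs≢v , xs-unique ← Unique-∷ʳ⁻ xs unique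
                                     with x∉xs , x≢v ← All.∷ʳ⁻ x∉ = (x≢v ∷ xs≢v) , (x∉xs ∷ xs-unique)

  extend-isPerm : ∀ {n π v} → IsPerm n π → v < suc n → IsPerm (suc n) (extend π v)
  extend-isPerm {n} {π} {v} (length≡n , π<n , unique) v≤n =
    trans (length-extend π v) (cong suc length≡n) ,
    All.++⁺ (All.map⁺ (All.map (punchIn-< v) π<n)) (v≤n ∷ []) ,
    Unique.++⁺ (Unique.map⁺ (punchIn-injective v) unique) ([] ∷ []) v∉
    where
    v∉ : ∀ {z} → z ∈ map (punchIn v) π × z ∈ v ∷ [] → ⊥
    v∉ (z∈ , here refl) with x , _ , z≡ ← ∈-map⁻ (punchIn v) z∈ = punchInᵥ≢v v x (sym z≡)

  isPerm⇒extend : ∀ {n σ} → IsPerm (suc n) σ → ∃₂ λ π v → IsPerm n π × v < suc n × σ ≡ extend π v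
  isPerm⇒extend {n} {σ} isPerm with initLast σ
  isPerm⇒extend {n} {.[]}        (() , _)                   | []
  isPerm⇒extend {n} {.(xs ∷ʳ v)} (length≡ , σ<1+n , unique) | xs ∷ʳ′ v
    with xs≢v , xs-unique ← Unique-∷ʳ⁻ xs unique
    with xs<1+n , v≤n ← All.∷ʳ⁻ σ<1+n =
    map (punchOut v) xs , v ,
    (trans (List.length-map (punchOut v) xs) length-xs ,
     All.map⁺ (All.zipWith (λ (x<1+n , x≢v) → punchOut-< v≤n x<1+n x≢v) (xs<1+n , xs≢v)) ,
     Unique.map⁻ (subst Unique (sym punchIn-punchOut-xs) xs-unique)) ,
    v≤n ,
    cong (_∷ʳ v) (sym punchIn-punchOut-xs)
    where
    punchIn-punchOut-xs : map (punchIn v) (map (punchOut v) xs) ≡ xs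
    punchIn-punchOut-xs = trans (sym (List.map-∘ xs)) (trans (List.map-cong-local (All.map punchIn-punchOut xs≢v)) (List.map-id xs))
    length-xs : length xs ≡ n
    length-xs = suc-injective (trans (sym (length-∷ʳ xs v)) length≡)

  Sym-suc↭ : ∀ n → Sym (suc n) ↭ cartesianProductWith extend (Sym n) (upTo (suc n))
  Sym-suc↭ n = ∼bag⇒↭ (unique∧set⇒bag (Sym-unique (suc n)) extend-unique (mk⇔ to from))
    where
    extend-unique = Unique.cartesianProductWith⁺ extend extend-injective (Sym-unique n) (Unique.upTo⁺ (suc n))
    to : ∀ {σ} → σ ∈ Sym (suc n) → σ ∈ cartesianProductWith extend (Sym n) (upTo (suc n))
    to σ∈ with π , v , π-isPerm , v≤n , refl ← isPerm⇒extend (∈-Sym⁻ (suc n) σ∈) =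
      ∈-cartesianProductWith⁺ extend (∈-Sym⁺ n π-isPerm) (∈-upTo⁺ v≤n)
    from : ∀ {σ} → σ ∈ cartesianProductWith extend (Sym n) (upTo (suc n)) → σ ∈ Sym (suc n)
    from σ∈ with π , v , π∈ , v∈ , refl ← ∈-cartesianProductWith⁻ extend (Sym n) (upTo (suc n)) σ∈ =
      ∈-Sym⁺ (suc n) (extend-isPerm (∈-Sym⁻ n π∈) (∈-upTo⁻ v∈))

  sum-map-Sym-suc : ∀ n (F : List ℕ → ℕ) →
    sum (map F (Sym (suc n))) ≡ sum (map (λ π → sumUpTo (suc n) (F ∘ extend π)) (Sym n))
  sum-map-Sym-suc n F = begin
    sum (map F (Sym (suc n)))
      ≡⟨ sum-↭ (↭.map⁺ F (Sym-suc↭ n)) ⟩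
    sum (map F (cartesianProductWith extend (Sym n) (upTo (suc n))))
      ≡⟨ sum-map-cartesianProductWith extend F (Sym n) (upTo (suc n)) ⟩
    sum (map (λ π → sum (map (F ∘ extend π) (upTo (suc n)))) (Sym n))
      ≡⟨ cong sum (List.map-cong (λ π → sum-map-upTo≡sumUpTo (F ∘ extend π) (suc n)) (Sym n)) ⟩
    sum (map (λ π → sumUpTo (suc n) (F ∘ extend π)) (Sym n)) ∎
    where open ≡-Reasoning

  at-++ˡ : ∀ (xs ys : List ℕ) {j} → j < length xs → at (xs ++ ys) (suc j) ≡ at xs (suc j)
  at-++ˡ (x ∷ xs) ys {zero}  _       = refl
  at-++ˡ (x ∷ xs) ys {suc j} j<len = at-++ˡ xs ys (s<s⁻¹ j<len)

  at-map : ∀ f (xs : List ℕ) {j} → j < length xs → at (map f xs) (suc j) ≡ f (at xs (suc j))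
  at-map f (x ∷ xs) {zero}  _       = refl
  at-map f (x ∷ xs) {suc j} j<len = at-map f xs (s<s⁻¹ j<len)

  at-∷ʳ : ∀ (xs : List ℕ) v → at (xs ∷ʳ v) (suc (length xs)) ≡ v
  at-∷ʳ []       v = refl
  at-∷ʳ (x ∷ xs) v = at-∷ʳ xs v

  at-∈ : ∀ (xs : List ℕ) {j} → j < length xs → at xs (suc j) ∈ xs
  at-∈ (x ∷ xs) {zero}  _       = here refl
  at-∈ (x ∷ xs) {suc j} j<len = there (at-∈ xs (s<s⁻¹ j<len))

  at-extend : ∀ {n} π v {j} → length π ≡ n → 1 ≤ j → j ≤ n → at (extend π v) j ≡ punchIn v (at π j)
  at-extend π v {suc j} refl _ j<n =
    trans (at-++ˡ (map (punchIn v) π) (v ∷ []) (subst (j <_) (sym (List.length-map (punchIn v) π)) j<n))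
          (at-map (punchIn v) π j<n)

  at-extend-last : ∀ {n} π v → length π ≡ n → at (extend π v) (suc n) ≡ v
  at-extend-last π v refl =
    trans (cong (λ k → at (extend π v) (suc k)) (sym (List.length-map (punchIn v) π))) (at-∷ʳ (map (punchIn v) π) v)

  at-< : ∀ {n π i} → IsPerm n π → 1 ≤ i → i ≤ n → at π i < n
  at-< {π = π} {suc i} (refl , π<n , _) _ i<n = All.lookup π<n (at-∈ π i<n)

module Inversions where

  open import Data.Nat
  open import Data.Nat.Properties
  open import Data.Bool using (T)
  open import Data.Bool.ListAction using (all)
  open import Data.Bool.Properties using (T-≡; T-∧; ⇔→≡)
  open import Data.List using (_∷_; map; concatMap; cartesianProduct; length)
  open import Data.List.Membership.Propositional using (_∈_)
  open import Data.List.Membership.Propositional.Properties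
    using (∈-filter⁺; ∈-filter⁻; ∈-map⁺; ∈-map⁻; ∈-upTo⁺; ∈-upTo⁻; ∈-cartesianProductWith⁺; ∈-cartesianProductWith⁻)
  open import Data.List.Relation.Binary.Subset.Propositional using (_⊆_)
  open import Data.List.Relation.Unary.Any as Any using (here; there)
  import Data.List.Relation.Unary.Any.Properties as Any
  import Data.List.Relation.Unary.All as All
  import Data.List.Relation.Unary.All.Properties as All
  open import Data.Product using (_,_; proj₁; proj₂)
  open import Function using (_∘_; _⇔_; mk⇔; Equivalence)
  import Function.Properties.Equivalence as ⇔
  open import Relation.Binary.PropositionalEquality
  open ListSums using (concatMap-map≡cartesianProductWith)
  open Permutations using (extend; punchIn; punchIn-cancel-<; punchIn-mono-<; v<punchIn⇔v≤x; at-extend; at-extend-last)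

  T⇔T⇒≡ : ∀ {x y} → T x ⇔ T y → x ≡ y
  T⇔T⇒≡ x⇔y = ⇔→≡ (⇔.trans (⇔.sym T-≡) (⇔.trans x⇔y T-≡))

  ∈-range1⁻ : ∀ {n i} → i ∈ range1 n → 1 ≤ i × i ≤ n
  ∈-range1⁻ {n} i∈ with k , k∈ , refl ← ∈-map⁻ suc i∈ = s≤s z≤n , ∈-upTo⁻ k∈

  ∈-range1⁺ : ∀ {n i} → 1 ≤ i → i ≤ n → i ∈ range1 n
  ∈-range1⁺ {i = suc k} _ k<n = ∈-map⁺ suc (∈-upTo⁺ k<n)

  Inversion : (ℕ → ℕ) → ℕ → List ℕ → ℕ → ℕ → Set
  Inversion h n π i j = 1 ≤ i × i < j × j ≤ n × j ≤ h i × at π j < at π i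

  module _ (h : ℕ → ℕ) (n : ℕ) (π : List ℕ) where

    pairs≡ : concatMap (λ i → map (i ,_) (range1 n)) (range1 n) ≡ cartesianProduct (range1 n) (range1 n)
    pairs≡ = concatMap-map≡cartesianProductWith _,_ (range1 n) (range1 n)

    ∈-invh⁻ : ∀ {i j} → (i , j) ∈ invh h n π → Inversion h n π i j
    ∈-invh⁻ {i} {j} p∈ with p∈pairs , test ← ∈-filter⁻ _ p∈
      with _ , _ , i∈ , j∈ , refl ← ∈-cartesianProductWith⁻ _,_ (range1 n) (range1 n)
                                      (subst ((i , j) ∈_) pairs≡ p∈pairs)
      with i<j , rest ← Equivalence.to T-∧ (Equivalence.from T-≡ test)
      with j≤hi , πj<πi ← Equivalence.to T-∧ rest
      = proj₁ (∈-range1⁻ i∈) , <ᵇ⇒< i j i<j , proj₂ (∈-range1⁻ j∈) , ≤ᵇ⇒≤ j (h i) j≤hi , <ᵇ⇒< _ _ πj<πi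

    ∈-invh⁺ : ∀ {i j} → Inversion h n π i j → (i , j) ∈ invh h n π
    ∈-invh⁺ {i} {j} (1≤i , i<j , j≤n , j≤hi , πj<πi) =
      ∈-filter⁺ _ (subst ((i , j) ∈_) (sym pairs≡) (∈-cartesianProductWith⁺ _,_ i∈ j∈))
                  (Equivalence.to T-≡ (Equivalence.from T-∧ (<⇒<ᵇ i<j , Equivalence.from T-∧ (≤⇒≤ᵇ j≤hi , <⇒<ᵇ πj<πi))))
      where
      i∈ = ∈-range1⁺ 1≤i (<⇒≤ (<-≤-trans i<j j≤n))
      j∈ = ∈-range1⁺ (≤-trans 1≤i (<⇒≤ i<j)) j≤n

  T-pairEqᵇ⇔ : ∀ p q → T (pairEqᵇ p q) ⇔ p ≡ q
  T-pairEqᵇ⇔ (a , b) (c , d) = mk⇔ to from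
    where
    to : T (pairEqᵇ (a , b) (c , d)) → (a , b) ≡ (c , d)
    to t with a≡c , b≡d ← Equivalence.to T-∧ t = cong₂ _,_ (≡ᵇ⇒≡ a c a≡c) (≡ᵇ⇒≡ b d b≡d)
    from : (a , b) ≡ (c , d) → T (pairEqᵇ (a , b) (c , d))
    from refl = Equivalence.from T-∧ (≡⇒≡ᵇ a a refl , ≡⇒≡ᵇ b b refl)

  T-memᵇ⇔ : ∀ {p A} → T (memᵇ p A) ⇔ p ∈ A
  T-memᵇ⇔ {p} = mk⇔ (Any.map (Equivalence.to (T-pairEqᵇ⇔ p _)) ∘ Any.any⁻ (pairEqᵇ p) _)
                    (Any.any⁺ (pairEqᵇ p) ∘ Any.map (Equivalence.from (T-pairEqᵇ⇔ p _)))

  T-sameSetᵇ⇔ : ∀ {A B} → T (sameSetᵇ A B) ⇔ (A ⊆ B × B ⊆ A)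
  T-sameSetᵇ⇔ {A} {B} = ⇔.trans T-∧ (mk⇔ (λ (t₁ , t₂) → all⇒⊆ A B t₁ , all⇒⊆ B A t₂)
                                          (λ (A⊆B , B⊆A) → ⊆⇒all A B A⊆B , ⊆⇒all B A B⊆A))
    where
    all⇒⊆ : ∀ A B → T (all (λ p → memᵇ p B) A) → A ⊆ B
    all⇒⊆ A B t p∈ = Equivalence.to T-memᵇ⇔ (All.lookup (All.all⁺ _ A t) p∈)
    ⊆⇒all : ∀ A B → A ⊆ B → T (all (λ p → memᵇ p B) A)
    ⊆⇒all A B A⊆B = All.all⁻ _ (All.tabulate (Equivalence.from T-memᵇ⇔ ∘ A⊆B))

  module _ (h : ℕ → ℕ) {n : ℕ} (π : List ℕ) (v : ℕ) (length≡n : length π ≡ n) where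

    private
      σ = extend π v

      at-σ : ∀ {i} → 1 ≤ i → i ≤ n → at σ i ≡ punchIn v (at π i)
      at-σ = at-extend π v length≡n

    Inversion-extend⇔ : ∀ {i j} → j ≤ n → Inversion h (suc n) σ i j ⇔ Inversion h n π i j
    Inversion-extend⇔ {i} {j} j≤n = mk⇔
      (λ (1≤i , i<j , _ , j≤hi , σj<σi) →
         1≤i , i<j , j≤n , j≤hi ,
         punchIn-cancel-< v (subst₂ _<_ (at-σ (1≤j 1≤i i<j) j≤n) (at-σ 1≤i (i≤n i<j)) σj<σi))
      (λ (1≤i , i<j , _ , j≤hi , πj<πi) →
         1≤i , i<j , m≤n⇒m≤1+n j≤n , j≤hi ,
         subst₂ _<_ (sym (at-σ (1≤j 1≤i i<j) j≤n)) (sym (at-σ 1≤i (i≤n i<j))) (punchIn-mono-< v πj<πi))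
      where
      1≤j : 1 ≤ i → i < j → 1 ≤ j
      1≤j 1≤i i<j = ≤-trans 1≤i (<⇒≤ i<j)
      i≤n : i < j → i ≤ n
      i≤n i<j = <⇒≤ (<-≤-trans i<j j≤n)

    Inversion-extend-last⇔ : ∀ {i} → Inversion h (suc n) σ i (suc n) ⇔ (1 ≤ i × i ≤ n × suc n ≤ h i × v ≤ at π i)
    Inversion-extend-last⇔ {i} = mk⇔
      (λ (1≤i , i<1+n , _ , 1+n≤hi , v<σi) →
         1≤i , s≤s⁻¹ i<1+n , 1+n≤hi ,
         Equivalence.to (v<punchIn⇔v≤x v (at π i)) (subst₂ _<_ (at-extend-last π v length≡n) (at-σ 1≤i (s≤s⁻¹ i<1+n)) v<σi))
      (λ (1≤i , i≤n , 1+n≤hi , v≤πi) →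
         1≤i , s≤s i≤n , ≤-refl , 1+n≤hi ,
         subst₂ _<_ (sym (at-extend-last π v length≡n)) (sym (at-σ 1≤i i≤n)) (Equivalence.from (v<punchIn⇔v≤x v (at π i)) v≤πi))

  ≤jS : ∀ {S i j} → (i , j) ∈ S → j ≤ jS S
  ≤jS {(_ , j′) ∷ S} (here refl) = m≤m⊔n j′ (jS S)
  ≤jS {(_ , j′) ∷ S} (there p∈)  = ≤-trans (≤jS p∈) (m≤n⊔m j′ (jS S))

module Counting (h : ℕ → ℕ) (S : List (ℕ × ℕ)) where

  open import Data.Nat
  open import Data.Nat.Properties
  open import Data.Nat.Combinatorics using (_C_; nCn≡1; k>n⇒nCk≡0)
  open import Data.Nat.ListAction using (sum)
  open import Data.Bool using (Bool; true; false; T; _∧_; if_then_else_)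
  open import Data.Bool.Properties using (T-∧)
  open import Data.List using (map)
  import Data.List.Properties as List
  open import Data.List.Membership.Propositional using (_∈_)
  open import Data.List.Relation.Binary.Subset.Propositional using (_⊆_)
  import Data.List.Relation.Unary.All as All
  open import Data.Product using (_,_; proj₁; proj₂)
  open import Data.Sum using (inj₁; inj₂)
  open import Data.Empty using (⊥-elim)
  open import Function using (_∘_; _⇔_; mk⇔; Equivalence)
  import Function.Properties.Equivalence as ⇔
  open import Relation.Binary.PropositionalEquality
  open RangeSums
  open Binomials using (Σ[k+i]Ci≡[1+k+D]CD)
  open ListSums using (length-filter≡sum)
  open Permutations
  open Inversions
  open Polynomials using (binomialPoly; sumₚ; evalPoly-binomialPoly; evalPoly-sumₚ)

  valid : ℕ → List ℕ → Bool
  valid n π = sameSetᵇ (invh h n π) S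

  valid-cong : ∀ {m n π σ} → (∀ {i j} → Inversion h m π i j ⇔ Inversion h n σ i j) → valid m π ≡ valid n σ
  valid-cong {m} {n} {π} {σ} π⇔σ = T⇔T⇒≡ (⇔.trans T-sameSetᵇ⇔ (⇔.trans (mk⇔ to from) (⇔.sym T-sameSetᵇ⇔)))
    where
    π⊆σ : invh h m π ⊆ invh h n σ
    π⊆σ {i , j} = ∈-invh⁺ h n σ ∘ Equivalence.to π⇔σ ∘ ∈-invh⁻ h m π
    σ⊆π : invh h n σ ⊆ invh h m π
    σ⊆π {i , j} = ∈-invh⁺ h m π ∘ Equivalence.from π⇔σ ∘ ∈-invh⁻ h n σ
    to : invh h m π ⊆ S × S ⊆ invh h m π → invh h n σ ⊆ S × S ⊆ invh h n σ
    to (π⊆S , S⊆π) = π⊆S ∘ σ⊆π , π⊆σ ∘ S⊆π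
    from : invh h n σ ⊆ S × S ⊆ invh h n σ → invh h m π ⊆ S × S ⊆ invh h m π
    from (σ⊆S , S⊆σ) = σ⊆S ∘ π⊆σ , σ⊆π ∘ S⊆σ

  valid-extend-max : ∀ {n π} → IsPerm n π → valid (suc n) (extend π n) ≡ valid n π
  valid-extend-max {n} {π} isPerm@(length≡n , _) = valid-cong {π = extend π n} {σ = π} (mk⇔ to from)
    where
    from : ∀ {i j} → Inversion h n π i j → Inversion h (suc n) (extend π n) i j
    from inv@(_ , _ , j≤n , _) = Equivalence.from (Inversion-extend⇔ h π n length≡n j≤n) inv
    to : ∀ {i j} → Inversion h (suc n) (extend π n) i j → Inversion h n π i j
    to {i} {j} inv@(_ , _ , j≤1+n , _) with m≤n⇒m<n∨m≡n j≤1+n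
    ... | inj₁ j<1+n = Equivalence.to (Inversion-extend⇔ h π n length≡n (s≤s⁻¹ j<1+n)) inv
    ... | inj₂ refl with 1≤i , i≤n , _ , n≤πi ← Equivalence.to (Inversion-extend-last⇔ h π n length≡n) inv =
      ⊥-elim (<⇒≱ (at-< isPerm 1≤i i≤n) n≤πi)

  at≤at-last : ∀ {n π i} → jS S < n → invh h n π ⊆ S → 1 ≤ i → i ≤ n → n ≤ h i → at π i ≤ at π n
  at≤at-last {n} {π} {i} jS<n π⊆S 1≤i i≤n n≤hi with m≤n⇒m<n∨m≡n i≤n
  ... | inj₂ refl = ≤-refl
  ... | inj₁ i<n  = ≮⇒≥ λ πn<πi → <⇒≱ jS<n (≤jS (π⊆S (∈-invh⁺ h n π (1≤i , i<n , ≤-refl , n≤hi , πn<πi))))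

  valid-extend-above : Exceeds h → ∀ {n π} v → jS S < n → IsPerm n π →
                    valid (suc n) (extend π v) ≡ valid n π ∧ (at π n <ᵇ v)
  valid-extend-above h>id {n} {π} v jS<n (length≡n , _) =
    T⇔T⇒≡ (⇔.trans T-sameSetᵇ⇔ (⇔.trans (mk⇔ to from) (⇔.sym T-∧)))
    where
    σ = extend π v
    1≤n = ≤-trans (s≤s z≤n) jS<n
    F1 = Inversion-extend⇔ h π v length≡n
    F2 = Inversion-extend-last⇔ h π v length≡n

    π⊆σ : invh h n π ⊆ invh h (suc n) σ
    π⊆σ {i , j} p∈ with inv@(_ , _ , j≤n , _) ← ∈-invh⁻ h n π p∈ = ∈-invh⁺ h (suc n) σ (Equivalence.from (F1 j≤n) inv)

    σ⊆π : ∀ {i j} → j ≤ n → (i , j) ∈ invh h (suc n) σ → (i , j) ∈ invh h n π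
    σ⊆π j≤n = ∈-invh⁺ h n π ∘ Equivalence.to (F1 j≤n) ∘ ∈-invh⁻ h (suc n) σ

    to : invh h (suc n) σ ⊆ S × S ⊆ invh h (suc n) σ → T (valid n π) × T (at π n <ᵇ v)
    to (σ⊆S , S⊆σ) = Equivalence.from T-sameSetᵇ⇔ (σ⊆S ∘ π⊆σ , S⊆π) , <⇒<ᵇ πn<v
      where
      S⊆π : S ⊆ invh h n π
      S⊆π p∈ = σ⊆π (≤-trans (≤jS p∈) (<⇒≤ jS<n)) (S⊆σ p∈)
      πn<v : at π n < v
      πn<v = ≰⇒> λ v≤πn →
        <⇒≱ (m<n⇒m<1+n jS<n) (≤jS (σ⊆S (∈-invh⁺ h (suc n) σ (Equivalence.from F2 (1≤n , ≤-refl , h>id n 1≤n , v≤πn)))))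

    from : T (valid n π) × T (at π n <ᵇ v) → invh h (suc n) σ ⊆ S × S ⊆ invh h (suc n) σ
    from (t , πn<ᵇv) = σ⊆S , π⊆σ ∘ S⊆π
      where
      π⊆S = proj₁ (Equivalence.to T-sameSetᵇ⇔ t)
      S⊆π = proj₂ (Equivalence.to T-sameSetᵇ⇔ t)
      σ⊆S : invh h (suc n) σ ⊆ S
      σ⊆S {i , j} p∈ with inv@(_ , _ , j≤1+n , _) ← ∈-invh⁻ h (suc n) σ p∈ with m≤n⇒m<n∨m≡n j≤1+n
      ... | inj₁ j<1+n = π⊆S (σ⊆π (s≤s⁻¹ j<1+n) p∈)
      ... | inj₂ refl with 1≤i , i≤n , 1+n≤hi , v≤πi ← Equivalence.to F2 inv =
        ⊥-elim (<⇒≱ (<ᵇ⇒< _ _ πn<ᵇv) (≤-trans v≤πi πi≤πn))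
        where
        πi≤πn = at≤at-last {π = π} jS<n π⊆S 1≤i i≤n (≤-trans (n≤1+n n) 1+n≤hi)

  gap : ℕ → List ℕ → ℕ
  gap n π = n ∸ suc (at π n)

  weighted : ℕ → (ℕ → ℕ) → ℕ
  weighted n φ = sum (map (λ π → if valid n π then φ (gap n π) else 0) (Sym n))

  Ih≡weighted-1 : ∀ n → Ih h S n ≡ weighted n (λ _ → 1)
  Ih≡weighted-1 n = length-filter≡sum (valid n) (Sym n)

  weighted-cong : ∀ n {φ ψ} → (∀ D → φ D ≡ ψ D) → weighted n φ ≡ weighted n ψ
  weighted-cong n φ≗ψ = cong sum (List.map-cong (λ π → cong (λ w → if valid n π then w else 0) (φ≗ψ (gap n π))) (Sym n))

  weighted-suc : ∀ n φ {F : List ℕ → ℕ} →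
                 (∀ {π} → IsPerm n π → sumUpTo (suc n) (λ v → if valid (suc n) (extend π v) then φ (n ∸ v) else 0) ≡ F π) →
                 weighted (suc n) φ ≡ sum (map F (Sym n))
  weighted-suc n φ {F} inner = begin
    weighted (suc n) φ
      ≡⟨ sum-map-Sym-suc n _ ⟩
    sum (map (λ π → sumUpTo (suc n) (λ v → if valid (suc n) (extend π v) then φ (gap (suc n) (extend π v)) else 0)) (Sym n))
      ≡⟨ cong sum (List.map-cong-local (All.tabulate (λ π∈ → let p = ∈-Sym⁻ n π∈ in trans (gap-extend p) (inner p)))) ⟩
    sum (map F (Sym n)) ∎
    where
    open ≡-Reasoning
    gap-extend : ∀ {π} → IsPerm n π →
      sumUpTo (suc n) (λ v → if valid (suc n) (extend π v) then φ (gap (suc n) (extend π v)) else 0) ≡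
      sumUpTo (suc n) (λ v → if valid (suc n) (extend π v) then φ (n ∸ v) else 0)
    gap-extend {π} (length≡n , _) =
      sumUpTo-cong (suc n) (λ v _ → cong (λ u → if valid (suc n) (extend π v) then φ (n ∸ u) else 0) (at-extend-last π v length≡n))

  weighted-suc-top : ∀ n φ → (∀ D → φ (suc D) ≡ 0) → weighted (suc n) φ ≡ weighted n (λ _ → φ 0)
  weighted-suc-top n φ φ[1+D]≡0 = weighted-suc n φ inner
    where
    inner : ∀ {π} → IsPerm n π →
            sumUpTo (suc n) (λ v → if valid (suc n) (extend π v) then φ (n ∸ v) else 0) ≡ (if valid n π then φ 0 else 0)
    inner {π} isPerm = begin
      sumUpTo (suc n) f               ≡⟨ sumUpTo-suc n f ⟩
      sumUpTo n f + f n               ≡⟨ cong (_+ f n) (sumUpTo≡0 n below) ⟩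
      f n                             ≡⟨ cong₂ (λ b u → if b then φ u else 0) (valid-extend-max isPerm) (n∸n≡0 n) ⟩
      (if valid n π then φ 0 else 0)  ∎
      where
      open ≡-Reasoning
      f : ℕ → ℕ
      f v = if valid (suc n) (extend π v) then φ (n ∸ v) else 0
      below : ∀ v → v < n → f v ≡ 0
      below v v<n with valid (suc n) (extend π v)
      ... | false = refl
      ... | true  = trans (cong φ (+-∸-assoc 1 v<n)) (φ[1+D]≡0 (n ∸ suc v))

  weighted-suc-above : Exceeds h → ∀ {n} φ → jS S < n → weighted (suc n) φ ≡ weighted n (λ D → sumUpTo (suc D) φ)
  weighted-suc-above h>id {n} φ jS<n = weighted-suc n φ inner
    where
    inner : ∀ {π} → IsPerm n π →
            sumUpTo (suc n) (λ v → if valid (suc n) (extend π v) then φ (n ∸ v) else 0) ≡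
            (if valid n π then sumUpTo (suc (gap n π)) φ else 0)
    inner {π} isPerm = trans (sumUpTo-cong (suc n) λ v _ → cong (λ b → if b then φ (n ∸ v) else 0) (valid-extend-above h>id v jS<n isPerm))
                             (by-validity (valid n π))
      where
      by-validity : ∀ b → sumUpTo (suc n) (λ v → if b ∧ (at π n <ᵇ v) then φ (n ∸ v) else 0) ≡
                          (if b then sumUpTo (suc (gap n π)) φ else 0)
      by-validity false = sumUpTo≡0 (suc n) (λ _ _ → refl)
      by-validity true  = sumUpTo-above φ (at-< isPerm (≤-trans (s≤s z≤n) jS<n) ≤-refl)

  weighted-binomial-above : Exceeds h → ∀ {n} → jS S < n →
    ∀ t k → weighted (t + n) (λ D → (k + D) C D) ≡ weighted n (λ D → (t + k + D) C D)
  weighted-binomial-above h>id     jS<n zero    k = refl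
  weighted-binomial-above h>id {n} jS<n (suc t) k = begin
    weighted (suc (t + n)) (λ D → (k + D) C D)
      ≡⟨ weighted-suc-above h>id (λ D → (k + D) C D) (<-≤-trans jS<n (m≤n+m n t)) ⟩
    weighted (t + n) (λ D → sumUpTo (suc D) (λ i → (k + i) C i))
      ≡⟨ weighted-cong (t + n) (Σ[k+i]Ci≡[1+k+D]CD k) ⟩
    weighted (t + n) (λ D → (suc k + D) C D)
      ≡⟨ weighted-binomial-above h>id jS<n t (suc k) ⟩
    weighted n (λ D → (t + suc k + D) C D)
      ≡⟨ cong (λ s → weighted n (λ D → (s + D) C D)) (+-suc t k) ⟩
    weighted n (λ D → (suc t + k + D) C D) ∎
    where open ≡-Reasoning

  Ih≡weighted : Exceeds h → ∀ {n} → jS S ≤ n → Ih h S n ≡ weighted (suc (jS S)) (λ D → (n + D ∸ suc (jS S)) C D)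
  Ih≡weighted h>id {n} m≤n with m≤n⇒m<n∨m≡n m≤n
  ... | inj₂ refl = begin
    Ih h S m                                      ≡⟨ Ih≡weighted-1 m ⟩
    weighted m (λ _ → 1)                          ≡⟨ weighted-suc-top m (λ D → pred D C D) (λ D → k>n⇒nCk≡0 (n<1+n D)) ⟨
    weighted (suc m) (λ D → pred D C D)           ≡⟨ weighted-cong (suc m) (λ D → cong (_C D) (m+D∸[1+m]≡pred D)) ⟨
    weighted (suc m) (λ D → (m + D ∸ suc m) C D)  ∎
    where
    open ≡-Reasoning
    m = jS S
    m+D∸[1+m]≡pred : ∀ D → m + D ∸ suc m ≡ pred D
    m+D∸[1+m]≡pred D = trans (sym (pred[m∸n]≡m∸[1+n] (m + D) m)) (cong pred (m+n∸m≡n m D))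
  ... | inj₁ m<n = begin
    Ih h S n                                      ≡⟨ Ih≡weighted-1 n ⟩
    weighted n (λ _ → 1)                          ≡⟨ weighted-cong n (λ D → sym (nCn≡1 D)) ⟩
    weighted n (λ D → (0 + D) C D)                ≡⟨ cong (λ k → weighted k (λ D → (0 + D) C D)) (m∸n+n≡m m<n) ⟨
    weighted (t + suc m) (λ D → (0 + D) C D)      ≡⟨ weighted-binomial-above h>id ≤-refl t 0 ⟩
    weighted (suc m) (λ D → (t + 0 + D) C D)      ≡⟨ weighted-cong (suc m) (λ D → cong (λ s → (s + D) C D) (+-identityʳ t)) ⟩
    weighted (suc m) (λ D → (t + D) C D)          ≡⟨ weighted-cong (suc m) (λ D → cong (_C D) (+-∸-comm D m<n)) ⟨
    weighted (suc m) (λ D → (n + D ∸ suc m) C D)  ∎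
    where
    open ≡-Reasoning
    m = jS S
    t = n ∸ suc m

  countingPoly : List ℚ
  countingPoly = sumₚ (map (λ π → if valid (suc m) π then binomialPoly (suc m) (gap (suc m) π) else []) (Sym (suc m)))
    where m = jS S

  evalPoly-countingPoly : ∀ {n} → jS S ≤ n →
    evalPoly countingPoly (ℕtoℚ n) ≡ ℕtoℚ (weighted (suc (jS S)) (λ D → (n + D ∸ suc (jS S)) C D))
  evalPoly-countingPoly {n} m≤n = evalPoly-sumₚ _ _ (ℕtoℚ n) by-validity (Sym (suc m))
    where
    m = jS S
    by-validity : ∀ π → evalPoly (if valid (suc m) π then binomialPoly (suc m) (gap (suc m) π) else []) (ℕtoℚ n) ≡
                        ℕtoℚ (if valid (suc m) π then (n + gap (suc m) π ∸ suc m) C gap (suc m) π else 0)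
    by-validity π with valid (suc m) π
    ... | true  = evalPoly-binomialPoly (suc m) (gap (suc m) π) (s≤s m≤n)
    ... | false = refl

corollary2p10 : (h : ℕ → ℕ) → WeaklyIncreasing h → Exceeds h →
    (S : List (ℕ × ℕ)) → S ≢ [] → Admissible h S →
    Σ (List ℚ) λ p → ∀ n → jS S ≤ n → evalPoly p (ℕtoℚ n) ≡ ℕtoℚ (Ih h S n)
corollary2p10 h _ h>id S _ _ = countingPoly , λ n m≤n →
  trans (evalPoly-countingPoly m≤n) (cong ℕtoℚ (sym (Ih≡weighted h>id m≤n)))
  where open Counting h S
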